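{- Let $\Phi$ be a gain graph with gain group $\mathfrak{G}$, let $\mathfrak{C}$ be a set on which $\mathfrak{G}$ acts on the right without fixed points (only the identity has fixed points), and let $x:V\to\mathfrak{C}$ be a coloration. Then the improper edge set $I(x)$ is balanced and closed.
   Context: $\Phi$ has a finite graph with vertex set $V=\{v_1,\dots,v_n\}$ (links, loops, half edges, loose edges, multiple edges allowed) and gains $\varphi(e)\in\mathfrak{G}$ on links and loops with $\varphi(e^{ -1})=\varphi(e)^{ -1}$; $e_{ij}$ denotes an edge oriented from $v_i$ to $v_j$; the gain of a walk is the product of its edge gains. A loose edge is treated as a loop of gain $1$. A circle is a connected 2-regular subgraph without half edges; an edge set is balanced if it has no half edges and every circle in it has gain $1$. A balanced set $S$ is closed if it contains every edge $e$ lying in a balanced circle contained in $S\cup\{e\}$ (equivalently, every edge $e_{ij}$ whose endpoints are joined by a path in $S$ with the same gain as $e_{ij}$). Writing $x_i=x(v_i)$, the improper edge set is $I(x)=\{e_{ij}: x_j=x_i\varphi(e_{ij})\}$ (half edges are never improper). -}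

module Defs where

open import Level using (Level; _⊔_)
open import Data.Nat using (ℕ)
open import Data.Fin using (Fin)
open import Data.Bool using (Bool; true; false)
open import Data.List using (List; []; _∷_; map)
open import Data.List.Relation.Unary.All using (All)
open import Data.List.Relation.Unary.Unique.Propositional using (Unique)
open import Data.Product using (_×_)
open import Data.Empty using (⊥)
import Data.Empty.Polymorphic as P⊥
open import Data.Sum using (_⊎_)
open import Data.List.Membership.Propositional using (_∈_)
open import Data.Unit.Polymorphic using (⊤)
open import Relation.Binary.PropositionalEquality using (_≡_; _≢_)
open import Relation.Binary.Bundles using (Setoid)
open import Algebra.Bundles using (Group)

module GainGraphs {c ℓ} (𝔊 : Group c ℓ) where
  open Group 𝔊

  data Edge (n : ℕ) : Set c where
    link  : (i j : Fin n) → i ≢ j → Carrier → Edge n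
    loop  : Fin n → Carrier → Edge n
    half  : Fin n → Edge n
    loose : Edge n

  data DartOf {n : ℕ} : Edge n → Bool → Fin n → Fin n → Carrier → Set c where
    link-fw : ∀ {i j p g} → DartOf (link i j p g) true  i j g
    link-bw : ∀ {i j p g} → DartOf (link i j p g) false j i (g ⁻¹)
    loop-fw : ∀ {i g}     → DartOf (loop i g)     true  i i g
    loop-bw : ∀ {i g}     → DartOf (loop i g)     false i i (g ⁻¹)

  module _ {n m : ℕ} (E : Fin m → Edge n) where

    record Step : Set c where
      constructor step
      field
        edge : Fin m
        dir  : Bool
        tl   : Fin n
        hd   : Fin n
        gn   : Carrier
        dart : DartOf (E edge) dir tl hd gn
    open Step public

    Chain : Fin n → List Step → Fin n → Set c
    Chain a []      b = Level.Lift c (a ≡ b)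
    Chain a (s ∷ w) b = Level.Lift c (tl s ≡ a) × Chain (hd s) w b

    walkGain : List Step → Carrier
    walkGain []      = ε
    walkGain (s ∷ w) = gn s ∙ walkGain w

    -- A circle (connected 2-regular subgraph without half edges), given
    -- as a closed walk traversing it once: either a loose edge (a loop of
    -- gain 1) or a nonempty closed walk with distinct vertices and
    -- distinct edges.
    data Circle : Set c where
      looseCircle : (e : Fin m) → E e ≡ loose → Circle
      walkCircle  : (s : Step) (w : List Step) →
                    Chain (tl s) (s ∷ w) (tl s) →
                    Unique (map tl (s ∷ w)) →
                    Unique (map edge (s ∷ w)) →
                    Circle

    circleEdges : Circle → List (Fin m)
    circleEdges (looseCircle e _)      = e ∷ []
    circleEdges (walkCircle s w _ _ _) = map edge (s ∷ w)

    circleGain : Circle → Carrier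
    circleGain (looseCircle _ _)      = ε
    circleGain (walkCircle s w _ _ _) = walkGain (s ∷ w)

    BalancedCircle : Circle → Set ℓ
    BalancedCircle C = circleGain C ≈ ε

    IsHalf : Edge n → Set
    IsHalf (half _) = Data.Unit.Polymorphic.⊤
    IsHalf _        = ⊥

    Balanced : ∀ {p} → (Fin m → Set p) → Set (c ⊔ ℓ ⊔ p)
    Balanced S = (∀ e → S e → IsHalf (E e) → ⊥)
               × (∀ (C : Circle) → All S (circleEdges C) → BalancedCircle C)

    Closed : ∀ {p} → (Fin m → Set p) → Set (c ⊔ ℓ ⊔ p)
    Closed S = ∀ (e : Fin m) (C : Circle) →
               e ∈ circleEdges C →
               All (λ f → S f ⊎ f ≡ e) (circleEdges C) →
               BalancedCircle C → S e

record RightAction {c ℓ a b} (𝔊 : Group c ℓ) (ℭ : Setoid a b)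
       : Set (c ⊔ ℓ ⊔ a ⊔ b) where
  open Group 𝔊 renaming (Carrier to G; _≈_ to _≈G_)
  open Setoid ℭ renaming (Carrier to C; _≈_ to _≈C_)
  infixl 7 _·_
  field
    _·_       : C → G → C
    ·-cong    : ∀ {x y g h} → x ≈C y → g ≈G h → (x · g) ≈C (y · h)
    ·-identity : ∀ x → (x · ε) ≈C x
    ·-assoc   : ∀ x g h → (x · (g ∙ h)) ≈C ((x · g) · h)

FixedPointFree : ∀ {c ℓ a b} {𝔊 : Group c ℓ} {ℭ : Setoid a b} →
                 RightAction 𝔊 ℭ → Set (c ⊔ ℓ ⊔ a ⊔ b)
FixedPointFree {𝔊 = 𝔊} {ℭ} act =
  ∀ (g : Group.Carrier 𝔊) (x : Setoid.Carrier ℭ) →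
  Setoid._≈_ ℭ (RightAction._·_ act x g) x → Group._≈_ 𝔊 g (Group.ε 𝔊)

module _ {c ℓ a b} {𝔊 : Group c ℓ} {ℭ : Setoid a b}
         (act : RightAction 𝔊 ℭ) where
  open GainGraphs 𝔊
  open RightAction act
  open Setoid ℭ renaming (Carrier to C; _≈_ to _≈C_)

  ImproperEdge : ∀ {n} → (Fin n → C) → Edge n → Set b
  ImproperEdge x (link i j _ g) = x j ≈C (x i · g)
  ImproperEdge x (loop i g)     = x i ≈C (x i · g)
  ImproperEdge x (half _)       = P⊥.⊥
  ImproperEdge x loose          = ⊤   -- a loose edge is a loop of gain 1

  Improper : ∀ {n m} → (Fin m → Edge n) → (Fin n → C) → Fin m → Set b
  Improper E x e = ImproperEdge x (E e)

{-# OPTIONS --safe #-}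
-- Colours are transported along improper walks: if every edge of a walk w
-- from u to v is improper, then x v = x u · φ(w).  Around an improper circle
-- this reads x u · φ(C) = x u, so φ(C) = 1 because the action is free.
-- Conversely, if all edges of a balanced circle except e are improper,
-- transporting around the rest of the circle and cancelling the gain of the
-- remaining walk shows that e is improper.
module Submission where

open import Defs
open import Level using (lift)
open import Data.Nat using (ℕ)
open import Data.Fin using (Fin)
open import Data.Product using (_×_; _,_; curry)
open import Data.Sum using (_⊎_; inj₁; inj₂)
open import Data.Empty using (⊥; ⊥-elim)
open import Data.Unit.Polymorphic using (tt)
open import Data.List using (List; []; _∷_; map)
open import Data.List.Relation.Unary.All as All using (All; _∷_)
open import Data.List.Relation.Unary.Any using (here; there)
open import Data.List.Relation.Unary.AllPairs using (_∷_)
open import Data.List.Relation.Unary.Unique.Propositional using (Unique)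
open import Data.List.Membership.Propositional using (_∈_)
open import Relation.Binary.PropositionalEquality as ≡ using (_≡_; _≢_)
open import Relation.Binary.Bundles using (Setoid)
open import Algebra.Bundles using (Group)
import Algebra.Properties.Group as GroupProperties
import Relation.Binary.Reasoning.Setoid as SetoidReasoning

All-⊎-≢⇒All : ∀ {a p} {A : Set a} {P : A → Set p} {e : A} {xs : List A} →
              All (λ y → P y ⊎ y ≡ e) xs → All (e ≢_) xs → All P xs
All-⊎-≢⇒All = curry (All.zipWith λ where
  (inj₁ py  , _)   → py
  (inj₂ y≡e , e≢y) → ⊥-elim (e≢y (≡.sym y≡e)))

module RightActionProperties {c ℓ a b} {𝔊 : Group c ℓ} {ℭ : Setoid a b}
                             (act : RightAction 𝔊 ℭ) where
  open Group 𝔊 using (_∙_; ε; _⁻¹; inverseʳ) renaming (refl to reflG)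
  open GroupProperties 𝔊 using (⁻¹-involutive)
  open Setoid ℭ
  open RightAction act
  open SetoidReasoning ℭ

  ·-·⁻¹ : ∀ y g → (y · g) · g ⁻¹ ≈ y
  ·-·⁻¹ y g = begin
    (y · g) · g ⁻¹ ≈⟨ ·-assoc y g (g ⁻¹) ⟨
    y · (g ∙ g ⁻¹) ≈⟨ ·-cong refl (inverseʳ g) ⟩
    y · ε          ≈⟨ ·-identity y ⟩
    y              ∎

  ·-cancelʳ : ∀ {y z} g → y · g ≈ z · g → y ≈ z
  ·-cancelʳ {y} {z} g yg≈zg = begin
    y              ≈⟨ ·-·⁻¹ y g ⟨
    (y · g) · g ⁻¹ ≈⟨ ·-cong yg≈zg reflG ⟩
    (z · g) · g ⁻¹ ≈⟨ ·-·⁻¹ z g ⟩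
    z              ∎

  ≈·⇒≈·⁻¹ : ∀ {y z g} → z ≈ y · g → y ≈ z · g ⁻¹
  ≈·⇒≈·⁻¹ {y} {z} {g} z≈yg = trans (sym (·-·⁻¹ y g)) (·-cong (sym z≈yg) reflG)

  ≈·⁻¹⇒≈· : ∀ {y z g} → z ≈ y · g ⁻¹ → y ≈ z · g
  ≈·⁻¹⇒≈· {g = g} z≈yg⁻¹ = trans (≈·⇒≈·⁻¹ z≈yg⁻¹) (·-cong refl (⁻¹-involutive g))

module ImproperEdges {c ℓ a b} {𝔊 : Group c ℓ} {ℭ : Setoid a b}
                     (act : RightAction 𝔊 ℭ)
                     {n m : ℕ} (E : Fin m → GainGraphs.Edge 𝔊 n)
                     (x : Fin n → Setoid.Carrier ℭ) where
  open Group 𝔊 using () renaming (refl to reflG)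
  open Setoid ℭ
  open RightAction act
  open RightActionProperties act
  open GainGraphs 𝔊
  open SetoidReasoning ℭ

  I : Fin m → Set b
  I = Improper act E x

  improper⇒¬half : ∀ d → ImproperEdge act x d → IsHalf E d → ⊥
  improper⇒¬half (half _)       (lift ()) _
  improper⇒¬half (link _ _ _ _) _         ()
  improper⇒¬half (loop _ _)     _         ()
  improper⇒¬half loose          _         ()

  improper⇒dart : ∀ {d b u v g} → DartOf d b u v g → ImproperEdge act x d → x v ≈ x u · g
  improper⇒dart link-fw imp = imp
  improper⇒dart link-bw imp = ≈·⇒≈·⁻¹ imp
  improper⇒dart loop-fw imp = imp
  improper⇒dart loop-bw imp = ≈·⇒≈·⁻¹ imp

  dart⇒improper : ∀ {d b u v g} → DartOf d b u v g → x v ≈ x u · g → ImproperEdge act x d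
  dart⇒improper link-fw rel = rel
  dart⇒improper link-bw rel = ≈·⁻¹⇒≈· rel
  dart⇒improper loop-fw rel = rel
  dart⇒improper loop-bw rel = ≈·⁻¹⇒≈· rel

  improperWalk⇒transport : ∀ {u v} w → Chain E u w v → All I (map edge w) →
                           x v ≈ x u · walkGain E w
  improperWalk⇒transport []      (lift ≡.refl)       _ = sym (·-identity _)
  improperWalk⇒transport {u} {v} (s ∷ w) (lift ≡.refl , chain) (imp ∷ imps) = begin
    x v                         ≈⟨ improperWalk⇒transport w chain imps ⟩
    x (hd s) · walkGain E w     ≈⟨ ·-cong (improper⇒dart (dart s) imp) reflG ⟩
    (x u · gn s) · walkGain E w ≈⟨ ·-assoc (x u) (gn s) (walkGain E w) ⟨
    x u · walkGain E (s ∷ w)    ∎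

  transport⇒improper : ∀ {u v e} w → Chain E u w v → Unique (map edge w) →
                       e ∈ map edge w → All (λ f → I f ⊎ f ≡ e) (map edge w) →
                       x v ≈ x u · walkGain E w → I e
  transport⇒improper {u} {v} (s ∷ w) (lift ≡.refl , chain) (s∉w ∷ _)
                     (here ≡.refl) (_ ∷ imps) transport =
    dart⇒improper (dart s) (·-cancelʳ (walkGain E w) (begin
      x (hd s) · walkGain E w     ≈⟨ improperWalk⇒transport w chain (All-⊎-≢⇒All imps s∉w) ⟨
      x v                         ≈⟨ transport ⟩
      x u · walkGain E (s ∷ w)    ≈⟨ ·-assoc (x u) (gn s) (walkGain E w) ⟩
      (x u · gn s) · walkGain E w ∎))
  transport⇒improper (s ∷ w) _ (s∉w ∷ _) (there e∈w) (inj₂ ≡.refl ∷ _) _ =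
    ⊥-elim (All.lookup s∉w e∈w ≡.refl)
  transport⇒improper {u} {v} (s ∷ w) (lift ≡.refl , chain) (_ ∷ unique)
                     (there e∈w) (inj₁ imp ∷ imps) transport =
    transport⇒improper w chain unique e∈w imps (begin
      x v                         ≈⟨ transport ⟩
      x u · walkGain E (s ∷ w)    ≈⟨ ·-assoc (x u) (gn s) (walkGain E w) ⟩
      (x u · gn s) · walkGain E w ≈⟨ ·-cong (improper⇒dart (dart s) imp) reflG ⟨
      x (hd s) · walkGain E w     ∎)

  improper-balanced : FixedPointFree act → Balanced E I
  improper-balanced free = (λ e → improper⇒¬half (E e)) , balancedCircle
    where
    balancedCircle : ∀ C → All I (circleEdges E C) → BalancedCircle E C
    balancedCircle (looseCircle _ _)          _    = reflG
    balancedCircle (walkCircle s w chain _ _) imps =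
      free _ _ (sym (improperWalk⇒transport (s ∷ w) chain imps))

  improper-closed : Closed E I
  improper-closed _ (looseCircle _ isLoose) (here ≡.refl) _ _ =
    ≡.subst (ImproperEdge act x) (≡.sym isLoose) tt
  improper-closed _ (walkCircle s w chain _ unique) e∈C imps balanced =
    transport⇒improper (s ∷ w) chain unique e∈C imps
      (sym (trans (·-cong refl balanced) (·-identity _)))

lemma5p1 : ∀ {c ℓ a b} (𝔊 : Group c ℓ) (ℭ : Setoid a b) (act : RightAction 𝔊 ℭ) →
    FixedPointFree act →
    (n m : ℕ) (E : Fin m → GainGraphs.Edge 𝔊 n) (x : Fin n → Setoid.Carrier ℭ) →
    GainGraphs.Balanced 𝔊 E (Improper act E x) × GainGraphs.Closed 𝔊 E (Improper act E x)
lemma5p1 𝔊 ℭ act free n m E x = improper-balanced free , improper-closed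
  where open ImproperEdges act E x
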